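{- Let $\Sigma^{NL}$ be a nominal logic signature and consider the matching logic theory NLML (signature and axioms $Ax_{NLML}$ as described in the context). Then the following patterns (the matching-logic translations of the equivariance axioms of nominal logic, with all free variables universally quantified, for all name sorts and sorts for which they are well-sorted) are provable in matching logic (in its standard Hilbert-style proof system) from the axioms $Ax_{NLML}$: (E1) $(a\ a')\cdot((b\ b')\cdot x) = (((a\ a')\cdot b)\ ((a\ a')\cdot b'))\cdot((a\ a')\cdot x)$; (E2) $b \mathrel{\#} x \Rightarrow ((a\ a')\cdot b) \mathrel{\#} ((a\ a')\cdot x)$; (E3) $(a\ a')\cdot f(\vec{x}) = f((a\ a')\cdot\vec{x})$ for every function symbol $f$ of $\Sigma^{NL}$; (E4) $p(\vec{x}) \Rightarrow p((a\ a')\cdot\vec{x})$ for every relation symbol $p$ of $\Sigma^{NL}$; (E5) $(b\ b')\cdot[a]x = [(b\ b')\cdot a]((b\ b')\cdot x)$. Here $(a\ a')\cdot\vec{x}$ denotes componentwise swapping.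
   Context: Matching logic: a signature has a set of sorts (closed under finite products, with tupling and projection symbols, and containing a sort $Pred$), countably many variables of each sort, and symbols $\sigma \in \Sigma_{\tau_1,\dots,\tau_n;\tau}$. Patterns of sort $\tau$: $x{:}\tau \mid \phi\wedge\psi \mid \neg\phi \mid \exists x{:}\tau'.\phi \mid \sigma(\phi_1,\dots,\phi_n)$. A model gives a nonempty carrier $M_\tau$ for each sort, with $M_{Pred}=\{\star\}$, and for each symbol a map $\sigma_M: M_{\tau_1}\times\cdots\times M_{\tau_n}\to\mathcal{P}(M_\tau)$; under a valuation $\rho$ of variables, $[\![x]\!]=\{\rho(x)\}$, $\wedge$ is intersection, $\neg$ is complement in $M_\tau$, $\exists$ is union over all values of the bound variable, and $\sigma(\phi_1,\dots,\phi_n)$ denotes the pointwise extension $\bigcup\{\sigma_M(v_1,\dots,v_n)\mid v_i\in[\![\phi_i]\!]\}$. There are coercion symbols $\lceil\cdot\rceil\in\Sigma_{Pred;\tau}$ mapping $\star$ to $M_\tau$ (usually implicit), and equality $\phi=\psi$ of sort $Pred$ denotes $\{\star\}$ if $[\![\phi]\!]=[\![\psi]\!]$ and $\emptyset$ otherwise. $\vee,\Rightarrow,\Leftrightarrow,\forall,\top,\bot$ are the usual abbreviations ($\top$ is the whole carrier, $\bot$ the empty set). A pattern is valid in $M$ if it denotes the whole carrier under every valuation. NLML: start from a nominal logic signature $\Sigma^{NL}$ with name sorts $\alpha$, abstraction sorts $[\alpha]\tau$, function symbols (including swapping $(a\ a')\cdot x:\alpha\times\alpha\times\tau\to\tau$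 and abstraction $[a]x:\alpha\times\tau\to[\alpha]\tau$), constants, and relation symbols (including equality and freshness $a\mathrel{\#}x$ for $a$ of name sort, $x$ of any sort). Each relation symbol $R:\tau_1\times\cdots\times\tau_n$ becomes a matching logic symbol in $\Sigma_{\tau_1,\dots,\tau_n;Pred}$, and function symbols/constants become matching logic symbols. The axioms $Ax_{NLML}$ (free variables universally quantified) are: (S1) $(a\ a)\cdot x = x$; (S2) $(a\ a')\cdot((a\ a')\cdot x)=x$; (S3) $(a\ a')\cdot a = a'$; (EV) $(a\ b)\cdot\sigma(\vec{x}) = \sigma((a\ b)\cdot\vec{x})$ for every symbol $\sigma$ of the signature; (P) $\forall x{:}Pred.\ x=\top_{Pred}$; (F1) $a\mathrel{\#}x\wedge a'\mathrel{\#}x \Rightarrow (a\ a')\cdot x = x$; (F2) $a\mathrel{\#}a' \Leftrightarrow a\neq a'$ (same name sort); (F3) $\forall a{:}\alpha, a'{:}\alpha'.\ a\mathrel{\#}a'$ for distinct name sorts $\alpha\neq\alpha'$; (F4) $\forall\vec{x}.\exists a.\ a\mathrel{\#}\vec{x}$; (A1) $[a]x=[a']x' \Leftrightarrow (a=a'\wedge x=x')\vee(a\mathrel{\#}x'\wedge (a\ a')\cdot x = x')$; (A2) $\forall x{:}[\alpha]\tau.\exists a{:}\alpha, y{:}\tau.\ x=[a]y$; $(Fun_c)$ $\exists x.\ c=x$ for each constant $c$; $(Fun_f)$ $\forall\vec{z}.\exists x.\ f(\vec{z})=x$ for each function symbol $f$. -}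

module Defs where

open import Data.Nat using (ℕ; zero; suc; _+_)
open import Data.List using (List; []; _∷_; _++_; length; lookup)
open import Data.Fin using (Fin)
open import Data.Product using (_×_; _,_; proj₁; proj₂)
open import Data.Bool using (Bool; true; false) renaming (_∧_ to _∧ᵇ_; not to notᵇ)
open import Relation.Binary.PropositionalEquality using (_≡_)
open import Relation.Nullary using (¬_)

-- Sorts: name sorts α, data sorts δ, abstraction sorts [α]τ,
-- finite products, and the distinguished matching-logic sort Pred.

data Sort (N D : Set) : Set where
  nm   : N → Sort N D
  dt   : D → Sort N D
  abs  : N → Sort N D → Sort N D
  prod : List (Sort N D) → Sort N D
  pred : Sort N D

-- The user-supplied part consists of
-- name sorts, data sorts, function symbols (constants = function
-- symbols with no arguments) and relation symbols.  Swapping,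
-- abstraction, equality and freshness are added below as built-ins.

record NLSig : Set₁ where
  field
    NameSort : Set
    DataSort : Set
    FunSym   : Set
    funArgs  : FunSym → List (Sort NameSort DataSort)
    funRes   : FunSym → Sort NameSort DataSort
    RelSym   : Set
    relArgs  : RelSym → List (Sort NameSort DataSort)

data PF : Set where
  atom  : ℕ → PF
  _∧ᶠ_  : PF → PF → PF
  ¬ᶠ_   : PF → PF

evalPF : (ℕ → Bool) → PF → Bool
evalPF v (atom n) = v n
evalPF v (F ∧ᶠ G) = evalPF v F ∧ᵇ evalPF v G
evalPF v (¬ᶠ F)   = notᵇ (evalPF v F)

Tautology : PF → Set
Tautology F = (v : ℕ → Bool) → evalPF v F ≡ true

module ML (S : NLSig) where
  open NLSig S public

  Srt : Set
  Srt = Sort NameSort DataSort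

  data Fn : Set where
    userF : FunSym → Fn
    swapF : NameSort → Srt → Fn
    absF  : NameSort → Srt → Fn

  fnArgs : Fn → List Srt
  fnArgs (userF f)   = funArgs f
  fnArgs (swapF α τ) = nm α ∷ nm α ∷ τ ∷ []
  fnArgs (absF α τ)  = nm α ∷ τ ∷ []

  fnRes : Fn → Srt
  fnRes (userF f)   = funRes f
  fnRes (swapF α τ) = τ
  fnRes (absF α τ)  = abs α τ

  data Rl : Set where
    userR  : RelSym → Rl
    eqR    : Srt → Rl
    freshR : NameSort → Srt → Rl

  rlArgs : Rl → List Srt
  rlArgs (userR r)    = relArgs r
  rlArgs (eqR τ)      = τ ∷ τ ∷ []
  rlArgs (freshR α τ) = nm α ∷ τ ∷ []

  data Sym : List Srt → Srt → Set where
    fun  : (f : Fn) → Sym (fnArgs f) (fnRes f)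
    rel  : (r : Rl) → Sym (rlArgs r) pred
    coe  : (τ : Srt) → Sym (pred ∷ []) τ
    tup  : (τs : List Srt) → Sym τs (prod τs)
    proj : (τs : List Srt) (i : Fin (length τs)) →
           Sym (prod τs ∷ []) (lookup τs i)

  Var : Set
  Var = Srt × ℕ

  infixr 7 _∧ₚ_
  infixr 6 _∨ₚ_
  infixr 5 _⇒_
  infix 4 _⇔_
  infix 8 _≐_

  data Pat : Srt → Set
  data Pats : List Srt → Set

  data Pat where
    var  : (τ : Srt) → ℕ → Pat τ
    _∧ₚ_ : ∀ {τ} → Pat τ → Pat τ → Pat τ
    ¬ₚ_  : ∀ {τ} → Pat τ → Pat τ
    ∃ₚ   : ∀ {τ} → Var → Pat τ → Pat τ
    app  : ∀ {τs τ} → Sym τs τ → Pats τs → Pat τ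
    _≐_  : ∀ {τ} → Pat τ → Pat τ → Pat pred

  data Pats where
    []  : Pats []
    _∷_ : ∀ {τ τs} → Pat τ → Pats τs → Pats (τ ∷ τs)

  _∨ₚ_ : ∀ {τ} → Pat τ → Pat τ → Pat τ
  φ ∨ₚ ψ = ¬ₚ (¬ₚ φ ∧ₚ ¬ₚ ψ)

  _⇒_ : ∀ {τ} → Pat τ → Pat τ → Pat τ
  φ ⇒ ψ = ¬ₚ (φ ∧ₚ ¬ₚ ψ)

  _⇔_ : ∀ {τ} → Pat τ → Pat τ → Pat τ
  φ ⇔ ψ = (φ ⇒ ψ) ∧ₚ (ψ ⇒ φ)

  ∀ₚ : ∀ {τ} → Var → Pat τ → Pat τ
  ∀ₚ x φ = ¬ₚ ∃ₚ x (¬ₚ φ)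

  ⊥ₚ : (τ : Srt) → Pat τ
  ⊥ₚ τ = ∃ₚ (τ , 0) (var τ 0 ∧ₚ ¬ₚ var τ 0)

  ⊤ₚ : (τ : Srt) → Pat τ
  ⊤ₚ τ = ¬ₚ ⊥ₚ τ

  _++ₚ_ : ∀ {τs₁ τs₂} → Pats τs₁ → Pats τs₂ → Pats (τs₁ ++ τs₂)
  []       ++ₚ qs = qs
  (p ∷ ps) ++ₚ qs = p ∷ (ps ++ₚ qs)

  instPF : ∀ {τ} → (ℕ → Pat τ) → PF → Pat τ
  instPF s (atom n) = s n
  instPF s (F ∧ᶠ G) = instPF s F ∧ₚ instPF s G
  instPF s (¬ᶠ F)   = ¬ₚ instPF s F

  data NotFree (x : Var) : ∀ {τ} → Pat τ → Set
  data NotFreeS (x : Var) : ∀ {τs} → Pats τs → Set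

  data NotFree x where
    nf-var   : ∀ {τ n} → ¬ ((τ , n) ≡ x) → NotFree x (var τ n)
    nf-∧     : ∀ {τ} {φ ψ : Pat τ} → NotFree x φ → NotFree x ψ → NotFree x (φ ∧ₚ ψ)
    nf-¬     : ∀ {τ} {φ : Pat τ} → NotFree x φ → NotFree x (¬ₚ φ)
    nf-bound : ∀ {τ} {φ : Pat τ} → NotFree x (∃ₚ x φ)
    nf-∃     : ∀ {τ y} {φ : Pat τ} → NotFree x φ → NotFree x (∃ₚ y φ)
    nf-app   : ∀ {τs τ} {σ : Sym τs τ} {ps : Pats τs} → NotFreeS x ps → NotFree x (app σ ps)
    nf-≐     : ∀ {τ} {φ ψ : Pat τ} → NotFree x φ → NotFree x ψ → NotFree x (φ ≐ ψ)

  data NotFreeS x where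
    nf-[] : NotFreeS x []
    nf-∷  : ∀ {τ τs} {p : Pat τ} {ps : Pats τs} → NotFree x p → NotFreeS x ps → NotFreeS x (p ∷ ps)

  -- Subst x ψ φ φ' : φ' is φ[ψ/x], where ψ is free for x in φ
  data Subst : (x : Var) → Pat (proj₁ x) → ∀ {τ} → Pat τ → Pat τ → Set
  data SubstS : (x : Var) → Pat (proj₁ x) → ∀ {τs} → Pats τs → Pats τs → Set

  data Subst where
    s-hit   : ∀ {σ n} {ψ : Pat σ} → Subst (σ , n) ψ (var σ n) ψ
    s-miss  : ∀ {x ψ τ m} → ¬ ((τ , m) ≡ x) → Subst x ψ (var τ m) (var τ m)
    s-∧     : ∀ {x ψ τ} {φ₁ φ₂ φ₁' φ₂' : Pat τ} →
              Subst x ψ φ₁ φ₁' → Subst x ψ φ₂ φ₂' → Subst x ψ (φ₁ ∧ₚ φ₂) (φ₁' ∧ₚ φ₂')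
    s-¬     : ∀ {x ψ τ} {φ φ' : Pat τ} → Subst x ψ φ φ' → Subst x ψ (¬ₚ φ) (¬ₚ φ')
    s-bound : ∀ {x ψ τ} {φ : Pat τ} → Subst x ψ (∃ₚ x φ) (∃ₚ x φ)
    s-∃     : ∀ {x ψ τ y} {φ φ' : Pat τ} → ¬ (y ≡ x) → NotFree y ψ →
              Subst x ψ φ φ' → Subst x ψ (∃ₚ y φ) (∃ₚ y φ')
    s-nf    : ∀ {x ψ τ} {φ : Pat τ} → NotFree x φ → Subst x ψ φ φ
    s-app   : ∀ {x ψ τs τ} {σ : Sym τs τ} {ps ps' : Pats τs} →
              SubstS x ψ ps ps' → Subst x ψ (app σ ps) (app σ ps')
    s-≐     : ∀ {x ψ τ} {φ₁ φ₂ φ₁' φ₂' : Pat τ} →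
              Subst x ψ φ₁ φ₁' → Subst x ψ φ₂ φ₂' → Subst x ψ (φ₁ ≐ φ₂) (φ₁' ≐ φ₂')

  data SubstS where
    s-[] : ∀ {x ψ} → SubstS x ψ [] []
    s-∷  : ∀ {x ψ τ τs} {p p' : Pat τ} {ps ps' : Pats τs} →
           Subst x ψ p p' → SubstS x ψ ps ps' → SubstS x ψ (p ∷ ps) (p' ∷ ps')

  data Ctx (h : Srt) : Srt → Set where
    □    : Ctx h h
    node : ∀ {τs₁ τs₂ ρ υ} → Sym (τs₁ ++ ρ ∷ τs₂) υ →
           Pats τs₁ → Ctx h ρ → Pats τs₂ → Ctx h υ

  plug : ∀ {h τ} → Ctx h τ → Pat h → Pat τ
  plug □ φ = φ
  plug (node σ l C r) φ = app σ (l ++ₚ (plug C φ ∷ r))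

  Theory : Set₁
  Theory = ∀ {τ} → Pat τ → Set

  infix 2 _⊢_
  data _⊢_ (Γ : Theory) : ∀ {τ} → Pat τ → Set where
    hyp        : ∀ {τ} {φ : Pat τ} → Γ φ → Γ ⊢ φ
    taut       : ∀ {τ} (F : PF) → Tautology F → (s : ℕ → Pat τ) → Γ ⊢ instPF s F
    mp         : ∀ {τ} {φ ψ : Pat τ} → Γ ⊢ φ → Γ ⊢ (φ ⇒ ψ) → Γ ⊢ ψ
    ∃-quant    : ∀ {τ} (x : Var) (m : ℕ) {φ φ' : Pat τ} →
                 Subst x (var (proj₁ x) m) φ φ' → Γ ⊢ (φ' ⇒ ∃ₚ x φ)
    ∃-gen      : ∀ {τ} {x : Var} {φ ψ : Pat τ} → NotFree x ψ →
                 Γ ⊢ (φ ⇒ ψ) → Γ ⊢ (∃ₚ x φ ⇒ ψ)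
    prop-⊥     : ∀ {τs₁ τs₂ ρ υ} (σ : Sym (τs₁ ++ ρ ∷ τs₂) υ) (l : Pats τs₁) (r : Pats τs₂) →
                 Γ ⊢ (app σ (l ++ₚ (⊥ₚ ρ ∷ r)) ⇒ ⊥ₚ υ)
    prop-∨     : ∀ {τs₁ τs₂ ρ υ} (σ : Sym (τs₁ ++ ρ ∷ τs₂) υ) (l : Pats τs₁) (r : Pats τs₂)
                 (φ ψ : Pat ρ) →
                 Γ ⊢ (app σ (l ++ₚ ((φ ∨ₚ ψ) ∷ r)) ⇒
                      (app σ (l ++ₚ (φ ∷ r)) ∨ₚ app σ (l ++ₚ (ψ ∷ r))))
    prop-∃     : ∀ {τs₁ τs₂ ρ υ} (σ : Sym (τs₁ ++ ρ ∷ τs₂) υ) (l : Pats τs₁) (r : Pats τs₂)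
                 (x : Var) (φ : Pat ρ) → NotFreeS x l → NotFreeS x r →
                 Γ ⊢ (app σ (l ++ₚ (∃ₚ x φ ∷ r)) ⇒ ∃ₚ x (app σ (l ++ₚ (φ ∷ r))))
    framing    : ∀ {τs₁ τs₂ ρ υ} (σ : Sym (τs₁ ++ ρ ∷ τs₂) υ) (l : Pats τs₁) (r : Pats τs₂)
                 {φ ψ : Pat ρ} → Γ ⊢ (φ ⇒ ψ) →
                 Γ ⊢ (app σ (l ++ₚ (φ ∷ r)) ⇒ app σ (l ++ₚ (ψ ∷ r)))
    existence  : (x : Var) → Γ ⊢ ∃ₚ x (var (proj₁ x) (proj₂ x))
    singleton  : ∀ {τ υ} (C₁ C₂ : Ctx τ υ) (n : ℕ) (φ : Pat τ) →
                 Γ ⊢ ¬ₚ (plug C₁ (var τ n ∧ₚ φ) ∧ₚ plug C₂ (var τ n ∧ₚ ¬ₚ φ))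
    eq-intro   : ∀ {τ} {φ ψ : Pat τ} → Γ ⊢ (φ ⇔ ψ) → Γ ⊢ (φ ≐ ψ)
    eq-elim    : ∀ {τ} (x : Var) {φ₁ φ₂ : Pat (proj₁ x)} {χ χ₁ χ₂ : Pat τ} →
                 Subst x φ₁ χ χ₁ → Subst x φ₂ χ χ₂ →
                 Γ ⊢ (app (coe τ) ((φ₁ ≐ φ₂) ∷ []) ⇒ (χ₁ ⇒ χ₂))
    coe-var    : (τ : Srt) (n : ℕ) → Γ ⊢ app (coe τ) (var pred n ∷ [])

  sw : (α : NameSort) (τ : Srt) → Pat (nm α) → Pat (nm α) → Pat τ → Pat τ
  sw α τ a b x = app (fun (swapF α τ)) (a ∷ b ∷ x ∷ [])

  absp : (α : NameSort) (τ : Srt) → Pat (nm α) → Pat τ → Pat (abs α τ)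
  absp α τ a x = app (fun (absF α τ)) (a ∷ x ∷ [])

  fr : (α : NameSort) (τ : Srt) → Pat (nm α) → Pat τ → Pat pred
  fr α τ a x = app (rel (freshR α τ)) (a ∷ x ∷ [])

  swapAll : (α : NameSort) → Pat (nm α) → Pat (nm α) → ∀ {τs} → Pats τs → Pats τs
  swapAll α a b []             = []
  swapAll α a b (_∷_ {τ} p ps) = sw α τ a b p ∷ swapAll α a b ps

  varsFrom : ℕ → (τs : List Srt) → Pats τs
  varsFrom k []       = []
  varsFrom k (τ ∷ τs) = var τ k ∷ varsFrom (suc k) τs

  allVars : (τs : List Srt) → ℕ → ∀ {υ} → Pat υ → Pat υ
  allVars []       k φ = φ
  allVars (τ ∷ τs) k φ = ∀ₚ (τ , k) (allVars τs (suc k) φ)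

  freshAll : (α : NameSort) → Pat (nm α) → ∀ {τs} → Pats τs → Pat pred
  freshAll α a []             = ⊤ₚ pred
  freshAll α a (_∷_ {τ} p ps) = fr α τ a p ∧ₚ freshAll α a ps

  aᵥ a'ᵥ : (α : NameSort) → Pat (nm α)
  aᵥ α  = var (nm α) 0
  a'ᵥ α = var (nm α) 1

  bᵥ b'ᵥ : (β : NameSort) → Pat (nm β)
  bᵥ β  = var (nm β) 2
  b'ᵥ β = var (nm β) 3

  xᵥ x'ᵥ : (τ : Srt) → Pat τ
  xᵥ τ  = var τ 4
  x'ᵥ τ = var τ 5

  -- the axioms Ax_NLML (free variables implicitly universally quantified)
  data AxNLML : Theory where
    S1    : (α : NameSort) (τ : Srt) → AxNLML (sw α τ (aᵥ α) (aᵥ α) (xᵥ τ) ≐ xᵥ τ)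
    S2    : (α : NameSort) (τ : Srt) →
            AxNLML (sw α τ (aᵥ α) (a'ᵥ α) (sw α τ (aᵥ α) (a'ᵥ α) (xᵥ τ)) ≐ xᵥ τ)
    S3    : (α : NameSort) → AxNLML (sw α (nm α) (aᵥ α) (a'ᵥ α) (aᵥ α) ≐ a'ᵥ α)
    EV-fn : (α : NameSort) (f : Fn) →
            AxNLML (sw α (fnRes f) (aᵥ α) (a'ᵥ α) (app (fun f) (varsFrom 10 (fnArgs f)))
                    ≐ app (fun f) (swapAll α (aᵥ α) (a'ᵥ α) (varsFrom 10 (fnArgs f))))
    EV-rl : (α : NameSort) (r : Rl) →
            AxNLML (sw α pred (aᵥ α) (a'ᵥ α) (app (rel r) (varsFrom 10 (rlArgs r)))
                    ≐ app (rel r) (swapAll α (aᵥ α) (a'ᵥ α) (varsFrom 10 (rlArgs r))))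
    P     : AxNLML (∀ₚ (pred , 0) (var pred 0 ≐ ⊤ₚ pred))
    F1    : (α : NameSort) (τ : Srt) →
            AxNLML ((fr α τ (aᵥ α) (xᵥ τ) ∧ₚ fr α τ (a'ᵥ α) (xᵥ τ))
                    ⇒ (sw α τ (aᵥ α) (a'ᵥ α) (xᵥ τ) ≐ xᵥ τ))
    F2    : (α : NameSort) →
            AxNLML (fr α (nm α) (aᵥ α) (a'ᵥ α) ⇔ ¬ₚ (aᵥ α ≐ a'ᵥ α))
    F3    : (α α' : NameSort) → ¬ (α ≡ α') →
            AxNLML (∀ₚ (nm α , 0) (∀ₚ (nm α' , 1) (fr α (nm α') (aᵥ α) (a'ᵥ α'))))
    F4    : (α : NameSort) (τs : List Srt) →
            AxNLML (allVars τs 10 (∃ₚ (nm α , 0) (freshAll α (aᵥ α) (varsFrom 10 τs))))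
    A1    : (α : NameSort) (τ : Srt) →
            AxNLML ((absp α τ (aᵥ α) (xᵥ τ) ≐ absp α τ (a'ᵥ α) (x'ᵥ τ))
                    ⇔ (((aᵥ α ≐ a'ᵥ α) ∧ₚ (xᵥ τ ≐ x'ᵥ τ))
                       ∨ₚ (fr α τ (aᵥ α) (x'ᵥ τ) ∧ₚ (sw α τ (aᵥ α) (a'ᵥ α) (xᵥ τ) ≐ x'ᵥ τ))))
    A2    : (α : NameSort) (τ : Srt) →
            AxNLML (∀ₚ (abs α τ , 0) (∃ₚ (nm α , 0) (∃ₚ (τ , 1)
                      (var (abs α τ) 0 ≐ absp α τ (var (nm α) 0) (var τ 1)))))
    Fun   : (f : Fn) →
            AxNLML (allVars (fnArgs f) 10 (∃ₚ (fnRes f , 0)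
                      (app (fun f) (varsFrom 10 (fnArgs f)) ≐ var (fnRes f) 0)))

  E1 : (α β : NameSort) (τ : Srt) → Pat pred
  E1 α β τ =
    sw α τ (aᵥ α) (a'ᵥ α) (sw β τ (bᵥ β) (b'ᵥ β) (xᵥ τ))
    ≐ sw β τ (sw α (nm β) (aᵥ α) (a'ᵥ α) (bᵥ β)) (sw α (nm β) (aᵥ α) (a'ᵥ α) (b'ᵥ β))
             (sw α τ (aᵥ α) (a'ᵥ α) (xᵥ τ))

  E2 : (α β : NameSort) (τ : Srt) → Pat pred
  E2 α β τ =
    fr β τ (bᵥ β) (xᵥ τ)
    ⇒ fr β τ (sw α (nm β) (aᵥ α) (a'ᵥ α) (bᵥ β)) (sw α τ (aᵥ α) (a'ᵥ α) (xᵥ τ))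

  E3 : (α : NameSort) (f : Fn) → Pat pred
  E3 α f =
    sw α (fnRes f) (aᵥ α) (a'ᵥ α) (app (fun f) (varsFrom 10 (fnArgs f)))
    ≐ app (fun f) (swapAll α (aᵥ α) (a'ᵥ α) (varsFrom 10 (fnArgs f)))

  E4 : (α : NameSort) (r : Rl) → Pat pred
  E4 α r =
    app (rel r) (varsFrom 10 (rlArgs r))
    ⇒ app (rel r) (swapAll α (aᵥ α) (a'ᵥ α) (varsFrom 10 (rlArgs r)))

  E5 : (α β : NameSort) (τ : Srt) → Pat pred
  E5 α β τ =
    sw β (abs α τ) (bᵥ β) (b'ᵥ β) (absp α τ (aᵥ α) (xᵥ τ))
    ≐ absp α τ (sw β (nm α) (bᵥ β) (b'ᵥ β) (aᵥ α)) (sw β τ (bᵥ β) (b'ᵥ β) (xᵥ τ))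

-- E3 is the equivariance axiom EV itself, and E1 and E5 are the instances of EV
-- for the swapping and abstraction symbols, up to renaming of variables.
-- For a relation symbol p, EV only gives (a a')·p(x⃗) = p((a a')·x⃗) at sort
-- Pred, so E2 and E4 need p(x⃗) ⇒ (a a')·p(x⃗).  By Fun, swapping on Pred is
-- total, and by P its value is ⋆; the singleton-variable axiom turns
-- "σ(w) holds for every element w" into "ψ ⇒ σ(ψ)" for every pattern ψ.

module Submission where

open import Defs
open import Data.Bool using (Bool; true; false; T; not; _∧_)
open import Data.Bool.Properties using (T-∧; T-≡)
open import Data.List using ([]; _∷_; _++_)
open import Data.Nat using (ℕ; zero; suc; _<_; z<s; s<s; _<ᵇ_; _≟_)
open import Data.Nat.Properties using (1+n≢n; <⇒≢; m<n⇒m<1+n)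
open import Data.Unit using (tt)  -- the instance discharging the False (m ≟ n) side conditions
open import Data.Product using (_×_; _,_; proj₁; proj₂)
open import Data.Vec using (Vec; []; _∷_)
open import Function using (_∘_)
open import Function.Bundles using (module Equivalence)
open import Relation.Binary.PropositionalEquality using (_≡_; refl; sym; trans; cong; cong₂)
open import Relation.Nullary using (¬_)
open import Relation.Nullary.Decidable using (False; toWitnessFalse)

atomsBelow : ℕ → PF → Bool
atomsBelow n (atom i) = i <ᵇ n
atomsBelow n (F ∧ᶠ G) = atomsBelow n F ∧ atomsBelow n G
atomsBelow n (¬ᶠ F)   = atomsBelow n F

valuation : ∀ {n} → Vec Bool n → ℕ → Bool
valuation []       _       = false
valuation (b ∷ bs) zero    = b
valuation (b ∷ bs) (suc i) = valuation bs i

restrict : (n : ℕ) → (ℕ → Bool) → Vec Bool n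
restrict zero    v = []
restrict (suc n) v = v 0 ∷ restrict n (v ∘ suc)

valuation-restrict : ∀ n v i → T (i <ᵇ n) → valuation (restrict n v) i ≡ v i
valuation-restrict (suc n) v zero    _   = refl
valuation-restrict (suc n) v (suc i) i<n = valuation-restrict n (v ∘ suc) i i<n

evalPF-restrict : ∀ n v F → T (atomsBelow n F) →
                  evalPF (valuation (restrict n v)) F ≡ evalPF v F
evalPF-restrict n v (atom i) i<n   = valuation-restrict n v i i<n
evalPF-restrict n v (F ∧ᶠ G) below =
  let belowF , belowG = Equivalence.to T-∧ below
  in cong₂ _∧_ (evalPF-restrict n v F belowF) (evalPF-restrict n v G belowG)
evalPF-restrict n v (¬ᶠ F)   below = cong not (evalPF-restrict n v F below)

allVec : (n : ℕ) → (Vec Bool n → Bool) → Bool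
allVec zero    g = g []
allVec (suc n) g = allVec n (g ∘ (true ∷_)) ∧ allVec n (g ∘ (false ∷_))

allVec-sound : ∀ n g → T (allVec n g) → ∀ bs → T (g bs)
allVec-sound zero    g h []           = h
allVec-sound (suc n) g h (true ∷ bs)  = allVec-sound n _ (proj₁ (Equivalence.to T-∧ h)) bs
allVec-sound (suc n) g h (false ∷ bs) = allVec-sound n _ (proj₂ (Equivalence.to T-∧ h)) bs

truthTable : ℕ → PF → Bool
truthTable n F = atomsBelow n F ∧ allVec n (λ bs → evalPF (valuation bs) F)

truthTable-sound : ∀ n F → T (truthTable n F) → Tautology F
truthTable-sound n F h v =
  let below , valid = Equivalence.to T-∧ h
  in trans (sym (evalPF-restrict n v F below))
           (Equivalence.to T-≡ (allVec-sound n _ valid (restrict n v)))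

infixr 6 _∨ᶠ_
infixr 5 _⇒ᶠ_

_∨ᶠ_ _⇒ᶠ_ : PF → PF → PF
F ∨ᶠ G = ¬ᶠ ((¬ᶠ F) ∧ᶠ (¬ᶠ G))
F ⇒ᶠ G = ¬ᶠ (F ∧ᶠ (¬ᶠ G))

p q r : PF
p = atom 0
q = atom 1
r = atom 2

module Substitutions (S : NLSig) where
  open ML S

  private variable
    x : Var
    τ ρ : Srt
    φ₁ φ₁' φ₂ φ₂' : Pat τ

  distinct : ∀ {τ υ m n} {{m≢n : False (m ≟ n)}} → ¬ (_≡_ {A = Var} (τ , m) (υ , n))
  distinct {{m≢n}} = toWitnessFalse m≢n ∘ cong proj₂

  fresh : ∀ {υ n τ m} {{m≢n : False (m ≟ n)}} → NotFree (υ , n) (var τ m)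
  fresh {{m≢n}} = nf-var (distinct {{m≢n}})

  miss : ∀ {υ n} {ψ : Pat υ} {τ m} {{m≢n : False (m ≟ n)}} →
         Subst (υ , n) ψ (var τ m) (var τ m)
  miss {{m≢n}} = s-miss (distinct {{m≢n}})

  s-∀ : ∀ {ψ : Pat (proj₁ x)} {y} {φ φ' : Pat τ} → ¬ y ≡ x → NotFree y ψ → Subst x ψ φ φ' →
        Subst x ψ (∀ₚ y φ) (∀ₚ y φ')
  s-∀ y≢x y∉ψ sub = s-¬ (s-∃ y≢x y∉ψ (s-¬ sub))

  s-app₂ : ∀ {ψ : Pat (proj₁ x)} {υ} {σ : Sym (τ ∷ ρ ∷ []) υ} {φ₂ φ₂' : Pat ρ} →
           Subst x ψ φ₁ φ₁' → Subst x ψ φ₂ φ₂' →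
           Subst x ψ (app σ (φ₁ ∷ φ₂ ∷ [])) (app σ (φ₁' ∷ φ₂' ∷ []))
  s-app₂ sub₁ sub₂ = s-app (s-∷ sub₁ (s-∷ sub₂ s-[]))

  s-app₃ : ∀ {ψ : Pat (proj₁ x)} {υ} {σ : Sym (τ ∷ τ ∷ ρ ∷ []) υ} {φ₃ φ₃' : Pat ρ} →
           Subst x ψ φ₁ φ₁' → Subst x ψ φ₂ φ₂' → Subst x ψ φ₃ φ₃' →
           Subst x ψ (app σ (φ₁ ∷ φ₂ ∷ φ₃ ∷ [])) (app σ (φ₁' ∷ φ₂' ∷ φ₃' ∷ []))
  s-app₃ sub₁ sub₂ sub₃ = s-app (s-∷ sub₁ (s-∷ sub₂ (s-∷ sub₃ s-[])))

  nf-app₂ : ∀ {υ} {σ : Sym (τ ∷ ρ ∷ []) υ} {φ₂ : Pat ρ} →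
            NotFree x φ₁ → NotFree x φ₂ → NotFree x (app σ (φ₁ ∷ φ₂ ∷ []))
  nf-app₂ nf₁ nf₂ = nf-app (nf-∷ nf₁ (nf-∷ nf₂ nf-[]))

  nf-app₃ : ∀ {υ} {σ : Sym (τ ∷ τ ∷ ρ ∷ []) υ} {φ₃ : Pat ρ} →
            NotFree x φ₁ → NotFree x φ₂ → NotFree x φ₃ →
            NotFree x (app σ (φ₁ ∷ φ₂ ∷ φ₃ ∷ []))
  nf-app₃ nf₁ nf₂ nf₃ = nf-app (nf-∷ nf₁ (nf-∷ nf₂ (nf-∷ nf₃ nf-[])))

  nfS-++ : ∀ {τs₁ τs₂} {ls : Pats τs₁} {rs : Pats τs₂} →
           NotFreeS x ls → NotFreeS x rs → NotFreeS x (ls ++ₚ rs)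
  nfS-++ nf-[]         nfr = nfr
  nfS-++ (nf-∷ nf nfl) nfr = nf-∷ nf (nfS-++ nfl nfr)

  nfS-varsFrom : ∀ {υ n k} τs → n < k → NotFreeS (υ , n) (varsFrom k τs)
  nfS-varsFrom []       n<k = nf-[]
  nfS-varsFrom (τ ∷ τs) n<k =
    nf-∷ (nf-var (<⇒≢ n<k ∘ sym ∘ cong proj₂)) (nfS-varsFrom τs (m<n⇒m<1+n n<k))

module DerivedRules (S : NLSig) (Γ : ML.Theory S) where
  open ML S
  open Substitutions S

  private variable
    τ ρ : Srt
    n : ℕ
    x : Var
    φ φ' ψ χ θ : Pat τ

  -- The default ⊥ₚ is never reached: truthTable checks that all atoms are below n.
  assign : ∀ {n} → Vec (Pat τ) n → ℕ → Pat τ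
  assign {τ} []       _       = ⊥ₚ τ
  assign     (φ ∷ φs) zero    = φ
  assign     (φ ∷ φs) (suc i) = assign φs i

  tautology : ∀ {n} (F : PF) (φs : Vec (Pat τ) n) {valid : T (truthTable n F)} →
              Γ ⊢ instPF (assign φs) F
  tautology F φs {valid} = taut F (truthTable-sound _ F valid) (assign φs)

  ⇒-trans : Γ ⊢ φ ⇒ ψ → Γ ⊢ ψ ⇒ χ → Γ ⊢ φ ⇒ χ
  ⇒-trans {φ = φ} {ψ} {χ} φ⇒ψ ψ⇒χ =
    mp ψ⇒χ (mp φ⇒ψ (tautology ((p ⇒ᶠ q) ⇒ᶠ (q ⇒ᶠ r) ⇒ᶠ p ⇒ᶠ r) (φ ∷ ψ ∷ χ ∷ [])))

  ⇒-const : Γ ⊢ ψ → Γ ⊢ φ ⇒ ψ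
  ⇒-const {ψ = ψ} {φ} ⊢ψ = mp ⊢ψ (tautology (q ⇒ᶠ p ⇒ᶠ q) (φ ∷ ψ ∷ []))

  ⇒-discharge : Γ ⊢ φ ⇒ ψ ⇒ χ → Γ ⊢ ψ → Γ ⊢ φ ⇒ χ
  ⇒-discharge {φ = φ} {ψ} {χ} h ⊢ψ =
    mp ⊢ψ (mp h (tautology ((p ⇒ᶠ q ⇒ᶠ r) ⇒ᶠ q ⇒ᶠ p ⇒ᶠ r) (φ ∷ ψ ∷ χ ∷ [])))

  ∧-curry : Γ ⊢ φ ∧ₚ ψ ⇒ χ → Γ ⊢ φ ⇒ ψ ⇒ χ
  ∧-curry {φ = φ} {ψ} {χ} h = mp h (tautology ((p ∧ᶠ q ⇒ᶠ r) ⇒ᶠ p ⇒ᶠ q ⇒ᶠ r) (φ ∷ ψ ∷ χ ∷ []))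

  ¬-intro : Γ ⊢ φ ⇒ ¬ₚ φ → Γ ⊢ ¬ₚ φ
  ¬-intro {φ = φ} h = mp h (tautology ((p ⇒ᶠ ¬ᶠ p) ⇒ᶠ ¬ᶠ p) (φ ∷ []))

  ⊤-intro : ∀ τ → Γ ⊢ ⊤ₚ τ
  ⊤-intro τ = ¬-intro (∃-gen (nf-¬ nf-bound) (tautology (p ∧ᶠ (¬ᶠ p) ⇒ᶠ q) (var τ 0 ∷ ⊤ₚ τ ∷ [])))

  ∀-intro : Γ ⊢ φ → Γ ⊢ ∀ₚ x φ
  ∀-intro {φ = φ} {x} ⊢φ =
    ¬-intro (∃-gen (nf-¬ nf-bound) (mp ⊢φ (tautology (p ⇒ᶠ ¬ᶠ p ⇒ᶠ q) (φ ∷ ∀ₚ x φ ∷ []))))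

  ∀-elim : ∀ x m → Subst x (var (proj₁ x) m) φ φ' → Γ ⊢ ∀ₚ x φ → Γ ⊢ φ'
  ∀-elim {φ = φ} {φ'} x m sub ⊢∀φ =
    mp ⊢∀φ (mp (∃-quant x m (s-¬ sub))
               (tautology ((¬ᶠ p ⇒ᶠ q) ⇒ᶠ ¬ᶠ q ⇒ᶠ p) (φ' ∷ ∃ₚ x (¬ₚ φ) ∷ [])))

  rename : ∀ x m → Subst x (var (proj₁ x) m) φ φ' → Γ ⊢ φ → Γ ⊢ φ'
  rename x m sub = ∀-elim x m sub ∘ ∀-intro

  coe-intro : Γ ⊢ θ → Γ ⊢ app (coe τ) (θ ∷ [])
  coe-intro {τ = τ} ⊢θ =
    mp (coe-var τ 0) (framing {τs₁ = []} {τs₂ = []} (coe τ) [] [] (⇒-const ⊢θ))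

  coe-≐⇒ : Γ ⊢ app (coe τ) ((φ ≐ ψ) ∷ []) ⇒ φ ⇒ ψ
  coe-≐⇒ {τ = τ} = eq-elim (τ , 0) {χ = var τ 0} s-hit s-hit

  coe-≐⇐ : Γ ⊢ app (coe τ) ((φ ≐ ψ) ∷ []) ⇒ ψ ⇒ φ
  coe-≐⇐ {τ = τ} {φ} {ψ} =
    mp (eq-elim (τ , 0) {χ = ¬ₚ var τ 0} (s-¬ s-hit) (s-¬ s-hit))
       (tautology ((p ⇒ᶠ ¬ᶠ q ⇒ᶠ ¬ᶠ r) ⇒ᶠ p ⇒ᶠ r ⇒ᶠ q)
                  (app (coe τ) ((φ ≐ ψ) ∷ []) ∷ φ ∷ ψ ∷ []))

  ≐⇒ : Γ ⊢ φ ≐ ψ → Γ ⊢ φ ⇒ ψ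
  ≐⇒ φ≐ψ = mp (coe-intro φ≐ψ) coe-≐⇒

  ≐⇐ : Γ ⊢ φ ≐ ψ → Γ ⊢ ψ ⇒ φ
  ≐⇐ φ≐ψ = mp (coe-intro φ≐ψ) coe-≐⇐

  ⇒∃-∧ : NotFree (ρ , n) ψ → Γ ⊢ ψ ⇒ ∃ₚ (ρ , n) (var ρ n ∧ₚ ψ)
  ⇒∃-∧ {ρ = ρ} {n} n∉ψ =
    mp (existence (ρ , n))
       (∃-gen (nf-¬ (nf-∧ n∉ψ (nf-¬ nf-bound)))
              (∧-curry (∃-quant (ρ , n) n (s-∧ s-hit (s-nf n∉ψ)))))

  module _ {τs₁ τs₂ ρ} (σ : Sym (τs₁ ++ ρ ∷ τs₂) ρ) (ls : Pats τs₁) (rs : Pats τs₂) where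

    σ⟨_⟩ : Pat ρ → Pat ρ
    σ⟨ φ ⟩ = app σ (ls ++ₚ (φ ∷ rs))

    -- Splitting w into w ∧ ψ and w ∧ ¬ψ, the singleton-variable axiom forbids
    -- w ∧ ψ to meet σ⟨ w ∧ ¬ψ ⟩, so w ∧ ψ lies in σ⟨ w ∧ ψ ⟩ ⊆ σ⟨ ψ ⟩.
    app-inflationary : ∀ n {ψ} → NotFreeS (ρ , n) ls → NotFreeS (ρ , n) rs →
                       NotFree (ρ , n) ψ → Γ ⊢ σ⟨ var ρ n ⟩ → Γ ⊢ ψ ⇒ σ⟨ ψ ⟩
    app-inflationary n {ψ} n∉ls n∉rs n∉ψ σ⟨w⟩ =
      ⇒-trans (⇒∃-∧ n∉ψ)
              (∃-gen (nf-app (nfS-++ n∉ls (nf-∷ n∉ψ n∉rs)))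
                     (⇒-trans w∧ψ⇒σ⟨w∧ψ⟩ (framing σ ls rs w∧ψ⇒ψ)))
      where
      w : Pat ρ
      w = var ρ n

      w∧ψ⇒ψ : Γ ⊢ w ∧ₚ ψ ⇒ ψ
      w∧ψ⇒ψ = tautology (p ∧ᶠ q ⇒ᶠ q) (w ∷ ψ ∷ [])

      cases : Γ ⊢ σ⟨ w ∧ₚ ψ ⟩ ∨ₚ σ⟨ w ∧ₚ ¬ₚ ψ ⟩
      cases = mp (mp σ⟨w⟩ (framing σ ls rs (tautology (p ⇒ᶠ p ∧ᶠ q ∨ᶠ p ∧ᶠ (¬ᶠ q)) (w ∷ ψ ∷ []))))
                 (prop-∨ σ ls rs _ _)

      w∧ψ⇒σ⟨w∧ψ⟩ : Γ ⊢ w ∧ₚ ψ ⇒ σ⟨ w ∧ₚ ψ ⟩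
      w∧ψ⇒σ⟨w∧ψ⟩ =
        mp cases (mp (singleton □ (node σ ls □ rs) n ψ)
                     (tautology (¬ᶠ (p ∧ᶠ r) ⇒ᶠ q ∨ᶠ r ⇒ᶠ p ⇒ᶠ q)
                                (w ∧ₚ ψ ∷ σ⟨ w ∧ₚ ψ ⟩ ∷ σ⟨ w ∧ₚ ¬ₚ ψ ⟩ ∷ [])))

  ≐-pred⇐ : ∀ n {φ ψ : Pat pred} → NotFree (pred , n) (φ ≐ ψ) → Γ ⊢ (φ ≐ ψ) ⇒ ψ ⇒ φ
  ≐-pred⇐ n n∉φ≐ψ =
    ⇒-trans (app-inflationary {τs₁ = []} {τs₂ = []} (coe pred) [] [] n nf-[] nf-[] n∉φ≐ψ
                              (coe-var pred n))
            coe-≐⇐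

module Equivariance (S : NLSig) where
  open ML S
  open Substitutions S
  open DerivedRules S AxNLML

  ⊢pred-var : ∀ n → AxNLML ⊢ var pred n
  ⊢pred-var n =
    mp (⊤-intro pred) (≐⇐ (∀-elim (pred , 0) n (s-≐ s-hit (s-nf (nf-¬ nf-bound))) (hyp P)))

  swap-pred-total : ∀ α n → AxNLML ⊢ sw α pred (aᵥ α) (a'ᵥ α) (var pred (suc n))
  swap-pred-total α n =
    mp swap-has-value
       (∃-gen (nf-app₃ (nf-var (λ ())) (nf-var (λ ())) (nf-var (λ ())))
              (⇒-discharge (≐-pred⇐ (suc (suc n)) fresh-in-equation) (⊢pred-var 0)))
    where
    y z : Pat pred
    y = var pred (suc n)
    z = var pred 0

    swap-has-value : AxNLML ⊢ ∃ₚ (pred , 0) (sw α pred (aᵥ α) (a'ᵥ α) y ≐ z)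
    swap-has-value =
      ∀-elim (pred , 12) (suc n) (s-∃ (λ ()) (nf-var (λ ())) (s-≐ (s-app₃ miss miss s-hit) miss))
      (∀-elim (nm α , 11) 1
        (s-∀ distinct fresh (s-∃ (λ ()) (nf-var (λ ())) (s-≐ (s-app₃ miss s-hit miss) miss)))
      (∀-elim (nm α , 10) 0
        (s-∀ distinct fresh (s-∀ (λ ()) (nf-var (λ ()))
          (s-∃ (λ ()) (nf-var (λ ())) (s-≐ (s-app₃ s-hit miss miss) miss))))
      (hyp (Fun (swapF α pred)))))

    fresh-in-equation : NotFree (pred , suc (suc n)) (sw α pred (aᵥ α) (a'ᵥ α) y ≐ z)
    fresh-in-equation =
      nf-≐ (nf-app₃ (nf-var (λ ())) (nf-var (λ ())) (nf-var (1+n≢n ∘ sym ∘ cong proj₂)))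
           (nf-var (λ ()))

  swap-pred-inflationary : ∀ α n {ψ : Pat pred} → NotFree (pred , suc n) ψ →
                           AxNLML ⊢ ψ ⇒ sw α pred (aᵥ α) (a'ᵥ α) ψ
  swap-pred-inflationary α n n∉ψ =
    app-inflationary (fun (swapF α pred)) (aᵥ α ∷ a'ᵥ α ∷ []) [] (suc n)
                     (nf-∷ (nf-var (λ ())) (nf-∷ (nf-var (λ ())) nf-[])) nf-[] n∉ψ
                     (swap-pred-total α n)

  ⊢E1 : ∀ α β τ → AxNLML ⊢ E1 α β τ
  ⊢E1 α β τ =
    rename (τ , 12) 4
      (s-≐ (s-app₃ miss miss (s-app₃ miss miss s-hit))
           (s-app₃ (s-app₃ miss miss miss) (s-app₃ miss miss miss) (s-app₃ miss miss s-hit)))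
    (rename (nm β , 11) 3
      (s-≐ (s-app₃ miss miss (s-app₃ miss s-hit miss))
           (s-app₃ (s-app₃ miss miss miss) (s-app₃ miss miss s-hit) (s-app₃ miss miss miss)))
    (rename (nm β , 10) 2
      (s-≐ (s-app₃ miss miss (s-app₃ s-hit miss miss))
           (s-app₃ (s-app₃ miss miss s-hit) (s-app₃ miss miss miss) (s-app₃ miss miss miss)))
    (hyp (EV-fn α (swapF β τ)))))

  ⊢E2 : ∀ α β τ → AxNLML ⊢ E2 α β τ
  ⊢E2 α β τ =
    ⇒-trans (swap-pred-inflationary α 4 (nf-app₂ fresh fresh))
            (≐⇒ (rename (τ , 11) 4
                   (s-≐ (s-app₃ miss miss (s-app₂ miss s-hit))
                        (s-app₂ (s-app₃ miss miss miss) (s-app₃ miss miss s-hit)))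
                 (rename (nm β , 10) 2
                   (s-≐ (s-app₃ miss miss (s-app₂ s-hit miss))
                        (s-app₂ (s-app₃ miss miss s-hit) (s-app₃ miss miss miss)))
                 (hyp (EV-rl α (freshR β τ))))))

  ⊢E4 : ∀ α r → AxNLML ⊢ E4 α r
  ⊢E4 α r =
    ⇒-trans (swap-pred-inflationary α 1 (nf-app (nfS-varsFrom (rlArgs r) (s<s (s<s z<s)))))
            (≐⇒ (hyp (EV-rl α r)))

  ⊢E5 : ∀ α β τ → AxNLML ⊢ E5 α β τ
  ⊢E5 α β τ =
    rename (τ , 11) 4
      (s-≐ (s-app₃ miss miss (s-app₂ miss s-hit))
           (s-app₂ (s-app₃ miss miss miss) (s-app₃ miss miss s-hit)))
    (rename (nm α , 10) 0
      (s-≐ (s-app₃ miss miss (s-app₂ s-hit miss))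
           (s-app₂ (s-app₃ miss miss s-hit) (s-app₃ miss miss miss)))
    (rename (nm β , 1) 3
      (s-≐ (s-app₃ miss s-hit (s-app₂ miss miss))
           (s-app₂ (s-app₃ miss s-hit miss) (s-app₃ miss s-hit miss)))
    (rename (nm β , 0) 2
      (s-≐ (s-app₃ s-hit miss (s-app₂ miss miss))
           (s-app₂ (s-app₃ s-hit miss miss) (s-app₃ s-hit miss miss)))
    (hyp (EV-fn β (absF α τ))))))

proposition3p1 : (S : NLSig) → let open ML S in
      ((α β : NameSort) (τ : Srt) → AxNLML ⊢ E1 α β τ)
    × ((α β : NameSort) (τ : Srt) → AxNLML ⊢ E2 α β τ)
    × ((α : NameSort) (f : Fn) → AxNLML ⊢ E3 α f)
    × ((α : NameSort) (r : Rl) → AxNLML ⊢ E4 α r)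
    × ((α β : NameSort) (τ : Srt) → AxNLML ⊢ E5 α β τ)
proposition3p1 S = ⊢E1 , ⊢E2 , (λ α f → hyp (EV-fn α f)) , ⊢E4 , ⊢E5
  where
  open ML S using (hyp; EV-fn)
  open Equivariance S
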